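{- Let $r\ge 2$ be an integer and let $p\in (0,1/2]$. If $S$ is a set of size $r$, then there exists a probability distribution $\phi$ on the subsets of $S$ such that $\phi(S)=0$ and for each $T\subsetneq S$, $\sum_{T': T\subseteq T'\subseteq S} \phi(T') = p^{|T|}$. -}

module Defs where

open import Level using (Level; _⊔_; suc)
open import Data.Nat as ℕ using (ℕ; zero)
open import Data.Bool using (Bool)
open import Data.List using (List; []; _∷_; map; filter; foldr; _++_)
open import Data.Vec using (_∷_; [])
open import Data.Fin.Subset using (Subset; inside; outside; _⊆_; ⊤; ∣_∣)
open import Data.Fin.Subset.Properties using (_⊆?_)
open import Data.Product using (_×_)
open import Relation.Nullary using (¬_)
open import Relation.Binary.Structures using (IsTotalOrder)
open import Algebra.Bundles using (CommutativeRing)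
import Algebra.Bundles
import Algebra.Definitions.RawSemiring as RawSR

-- The real numbers are an instance.
record OrderedCommutativeRing (c ℓ ℓ' : Level) : Set (Level.suc (c ⊔ ℓ ⊔ ℓ')) where
  field
    commutativeRing : CommutativeRing c ℓ
  open CommutativeRing commutativeRing public
  infix 4 _≤_
  field
    _≤_          : Carrier → Carrier → Set ℓ'
    isTotalOrder : IsTotalOrder _≈_ _≤_
    +-mono-≤     : ∀ {x y} z → x ≤ y → (x + z) ≤ (y + z)
    *-nonneg     : ∀ {x y} → 0# ≤ x → 0# ≤ y → 0# ≤ (x * y)

  infix 4 _<_
  _<_ : Carrier → Carrier → Set (ℓ ⊔ ℓ')
  x < y = x ≤ y × ¬ (x ≈ y)

  open RawSR (Algebra.Bundles.Semiring.rawSemiring semiring) public using (_^_)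

allSubsets : (n : ℕ) → List (Subset n)
allSubsets zero    = [] ∷ []
allSubsets (ℕ.suc n) = map (outside ∷_) (allSubsets n) ++ map (inside ∷_) (allSubsets n)

module _ {c ℓ ℓ'} (R : OrderedCommutativeRing c ℓ ℓ') where
  open OrderedCommutativeRing R

  sumList : List Carrier → Carrier
  sumList = foldr _+_ 0#

  totalMass : {r : ℕ} → (Subset r → Carrier) → Carrier
  totalMass {r} φ = sumList (map φ (allSubsets r))

  upSum : {r : ℕ} → (Subset r → Carrier) → Subset r → Carrier
  upSum {r} φ T = sumList (map φ (filter (T ⊆?_) (allSubsets r)))

  IsProbDist : {r : ℕ} → (Subset r → Carrier) → Set (ℓ ⊔ ℓ')
  IsProbDist φ = (∀ T → 0# ≤ φ T) × totalMass φ ≈ 1#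

{-# OPTIONS --safe #-}
-- Let q = 1 - p and let w_b T = p ^ ∣ T ∣ * b ^ (r - ∣ T ∣) be the weight of the product
-- measure giving each point weight p inside T and b outside. Summing w_b over the
-- supersets of T factorises coordinatewise, giving p ^ ∣ T ∣ * (p + b) ^ (r - ∣ T ∣).
-- Hence φ = w_q - w_(-p) has up-sums p ^ ∣ T ∣ * (1 - 0 ^ (r - ∣ T ∣)), which is p ^ ∣ T ∣
-- for every T ≠ S; the total mass is the up-sum of the empty set, and φ S = p ^ r - p ^ r.
-- For nonnegativity, |-p| ≤ q because 2p ≤ 1, and the domination |y| ≤ x is
-- multiplicative, so |w_(-p)| ≤ w_q coordinatewise.
module Submission where

open import Defs
open import Data.Nat using (ℕ; zero; suc) renaming (_≤_ to _≤ℕ_)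
open import Data.Bool using (true; false)
open import Data.Empty using (⊥-elim)
open import Data.Fin.Subset using (Subset; inside; outside; ⊤; ⊥; ∣_∣)
open import Data.Fin.Subset.Properties using (_⊆?_; ⊥⊆; ∣⊥∣≡0)
open import Data.List using ([]; _∷_; map; filter; _++_)
open import Data.List.Properties using (filter-++; filter-all; map-++; map-∘)
open import Data.List.Relation.Unary.All using (universal)
open import Data.Product using (_×_; _,_; proj₁; ∃)
open import Data.Sum using (inj₁; inj₂)
open import Data.Vec using (_∷_; [])
open import Function using (_∘_)
open import Relation.Nullary using (does)
open import Relation.Unary using (Pred; Decidable)
open import Relation.Binary.PropositionalEquality as ≡ using (_≡_; _≢_)
open import Relation.Binary.Structures using (IsTotalOrder)
import Algebra.Properties.Ring as RingProperties
import Algebra.Properties.CommutativeSemigroup as CommutativeSemigroupProperties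

module _ {a b p q} {A : Set a} {B : Set b} {P : Pred B p} {Q : Pred A q}
         (P? : Decidable P) (Q? : Decidable Q) (f : A → B) where

  filter-map : (∀ x → does (P? (f x)) ≡ does (Q? x)) →
               ∀ xs → filter P? (map f xs) ≡ map f (filter Q? xs)
  filter-map eq []       = ≡.refl
  filter-map eq (x ∷ xs) with does (P? (f x)) | does (Q? x) | eq x
  ... | true  | true  | ≡.refl = ≡.cong (f x ∷_) (filter-map eq xs)
  ... | false | false | ≡.refl = filter-map eq xs

module _ {a b p} {A : Set a} {B : Set b} {P : Pred B p} (P? : Decidable P) (f : A → B) where

  filter-map-none : (∀ x → does (P? (f x)) ≡ false) → ∀ xs → filter P? (map f xs) ≡ []
  filter-map-none none []       = ≡.refl
  filter-map-none none (x ∷ xs) with does (P? (f x)) | none x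
  ... | false | ≡.refl = filter-map-none none xs

module _ {c ℓ ℓ'} (R : OrderedCommutativeRing c ℓ ℓ') where
  open OrderedCommutativeRing R
  open RingProperties ring
    using (-‿distribˡ-*; -‿involutive; -‿+-comm; -0#≈0#; xyx⁻¹≈y; x[y-z]≈xy-xz; [y-z]x≈yx-zx)
  open CommutativeSemigroupProperties +-commutativeSemigroup using (interchange)
  open IsTotalOrder isTotalOrder
    using (total; ≤-respˡ-≈; ≤-respʳ-≈) renaming (refl to ≤-refl; trans to ≤-trans)
  open import Relation.Binary.Reasoning.Setoid setoid

  [a-b]+[c-d]≈[a+c]-[b+d] : ∀ a b c d → (a - b) + (c - d) ≈ (a + c) - (b + d)
  [a-b]+[c-d]≈[a+c]-[b+d] a b c d = trans (interchange a (- b) c (- d)) (+-congˡ (-‿+-comm b d))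

  [a+c]-[b+c]≈a-b : ∀ a b c → (a + c) - (b + c) ≈ a - b
  [a+c]-[b+c]≈a-b a b c = begin
    (a + c) - (b + c)   ≈⟨ [a-b]+[c-d]≈[a+c]-[b+d] a b c c ⟨
    (a - b) + (c - c)   ≈⟨ +-congˡ (-‿inverseʳ c) ⟩
    (a - b) + 0#        ≈⟨ +-identityʳ (a - b) ⟩
    a - b               ∎

  x-0≈x : ∀ x → x - 0# ≈ x
  x-0≈x x = trans (+-congˡ -0#≈0#) (+-identityʳ x)

  [x-y][u+v]+[x+y][u-v]≈[xu-yv]+[xu-yv] : ∀ x y u v →
    (x - y) * (u + v) + (x + y) * (u - v) ≈ (x * u - y * v) + (x * u - y * v)
  [x-y][u+v]+[x+y][u-v]≈[xu-yv]+[xu-yv] x y u v = begin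
    (x - y) * (u + v) + (x + y) * (u - v)
      ≈⟨ +-cong (trans (distribˡ (x - y) u v) (+-cong ([y-z]x≈yx-zx u x y) ([y-z]x≈yx-zx v x y)))
                (trans (x[y-z]≈xy-xz (x + y) u v) (+-cong (distribʳ u x y) (-‿cong (distribʳ v x y)))) ⟩
    (x * u - y * u) + (x * v - y * v) + ((x * u + y * u) - (x * v + y * v))
      ≈⟨ +-congʳ ([a-b]+[c-d]≈[a+c]-[b+d] (x * u) (y * u) (x * v) (y * v)) ⟩
    (x * u + x * v) - (y * u + y * v) + ((x * u + y * u) - (x * v + y * v))
      ≈⟨ [a-b]+[c-d]≈[a+c]-[b+d] _ _ _ _ ⟩
    ((x * u + x * v) + (x * u + y * u)) - ((y * u + y * v) + (x * v + y * v))
      ≈⟨ +-cong (interchange (x * u) (x * v) (x * u) (y * u))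
                (-‿cong (trans (interchange (y * u) (y * v) (x * v) (y * v))
                               (trans (+-comm _ _) (+-congˡ (+-comm (y * u) (x * v)))))) ⟩
    ((x * u + x * u) + (x * v + y * u)) - ((y * v + y * v) + (x * v + y * u))
      ≈⟨ [a+c]-[b+c]≈a-b _ _ _ ⟩
    (x * u + x * u) - (y * v + y * v)
      ≈⟨ [a-b]+[c-d]≈[a+c]-[b+d] _ _ _ _ ⟨
    (x * u - y * v) + (x * u - y * v) ∎

  +-nonneg : ∀ {x y} → 0# ≤ x → 0# ≤ y → 0# ≤ x + y
  +-nonneg {x} {y} 0≤x 0≤y = ≤-trans 0≤y (≤-respˡ-≈ (+-identityˡ y) (+-mono-≤ y 0≤x))

  x≤y⇒0≤y-x : ∀ {x y} → x ≤ y → 0# ≤ y - x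
  x≤y⇒0≤y-x {x} {y} x≤y = ≤-respˡ-≈ (-‿inverseʳ x) (+-mono-≤ (- x) x≤y)

  0≤x+x⇒0≤x : ∀ {x} → 0# ≤ x + x → 0# ≤ x
  0≤x+x⇒0≤x {x} 0≤x+x with total 0# x
  ... | inj₁ 0≤x = 0≤x
  ... | inj₂ x≤0 = ≤-trans 0≤x+x (≤-respʳ-≈ (+-identityˡ x) (+-mono-≤ x x≤0))

  0≤1 : 0# ≤ 1#
  0≤1 with total 0# 1#
  ... | inj₁ 0≤1 = 0≤1
  ... | inj₂ 1≤0 = ≤-respʳ-≈ -1*-1≈1 (*-nonneg 0≤-1 0≤-1)
    where
    0≤-1 : 0# ≤ - 1#
    0≤-1 = ≤-respʳ-≈ (+-identityˡ (- 1#)) (x≤y⇒0≤y-x 1≤0)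
    -1*-1≈1 : - 1# * - 1# ≈ 1#
    -1*-1≈1 = trans (sym (-‿distribˡ-* 1# (- 1#))) (trans (-‿cong (*-identityˡ (- 1#))) (-‿involutive 1#))

  infix 4 ∣_∣≤_
  ∣_∣≤_ : Carrier → Carrier → Set ℓ'
  ∣ y ∣≤ x = 0# ≤ x - y × 0# ≤ x + y

  -‿∣∣≤ : ∀ {x y} → ∣ y ∣≤ x → ∣ - y ∣≤ x
  -‿∣∣≤ {x} {y} (0≤x-y , 0≤x+y) = ≤-respʳ-≈ (+-congˡ (sym (-‿involutive y))) 0≤x+y , 0≤x-y

  *-∣∣≤ : ∀ {x y u v} → ∣ y ∣≤ x → ∣ v ∣≤ u → ∣ y * v ∣≤ x * u
  *-∣∣≤ {x} {y} {u} {v} y≤x v≤u = 0≤xu-yv y≤x v≤u , ≤-respʳ-≈ xu-[-y]v≈xu+yv (0≤xu-yv (-‿∣∣≤ y≤x) v≤u)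
    where
    0≤xu-yv : ∀ {x y u v} → ∣ y ∣≤ x → ∣ v ∣≤ u → 0# ≤ x * u - y * v
    0≤xu-yv {x} {y} {u} {v} (0≤x-y , 0≤x+y) (0≤u-v , 0≤u+v) =
      0≤x+x⇒0≤x (≤-respʳ-≈ ([x-y][u+v]+[x+y][u-v]≈[xu-yv]+[xu-yv] x y u v)
                            (+-nonneg (*-nonneg 0≤x-y 0≤u+v) (*-nonneg 0≤x+y 0≤u-v)))
    xu-[-y]v≈xu+yv : x * u - (- y * v) ≈ x * u + y * v
    xu-[-y]v≈xu+yv = +-congˡ (trans (-‿cong (sym (-‿distribˡ-* y v))) (-‿involutive (y * v)))

  sumList-++ : ∀ xs ys → sumList R (xs ++ ys) ≈ sumList R xs + sumList R ys
  sumList-++ []       ys = sym (+-identityˡ _)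
  sumList-++ (x ∷ xs) ys = trans (+-congˡ (sumList-++ xs ys)) (sym (+-assoc x _ _))

  module _ {a} {A : Set a} where

    sumList-map-*ˡ : ∀ k (w : A → Carrier) xs → sumList R (map (λ t → k * w t) xs) ≈ k * sumList R (map w xs)
    sumList-map-*ˡ k w []       = sym (zeroʳ k)
    sumList-map-*ˡ k w (x ∷ xs) = trans (+-congˡ (sumList-map-*ˡ k w xs)) (sym (distribˡ k _ _))

    sumList-map-- : ∀ (v w : A → Carrier) xs →
                    sumList R (map (λ t → v t - w t) xs) ≈ sumList R (map v xs) - sumList R (map w xs)
    sumList-map-- v w []       = sym (-‿inverseʳ 0#)
    sumList-map-- v w (x ∷ xs) = trans (+-congˡ (sumList-map-- v w xs)) ([a-b]+[c-d]≈[a+c]-[b+d] _ _ _ _)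

  upSum-*ˡ : ∀ {n} k (w : Subset n → Carrier) T → upSum R (λ t → k * w t) T ≈ k * upSum R w T
  upSum-*ˡ k w T = sumList-map-*ˡ k w (filter (T ⊆?_) (allSubsets _))

  upSum-- : ∀ {n} (v w : Subset n → Carrier) T → upSum R (λ t → v t - w t) T ≈ upSum R v T - upSum R w T
  upSum-- v w T = sumList-map-- v w (filter (T ⊆?_) (allSubsets _))

  upSum-inside∷ : ∀ {n} (w : Subset (suc n) → Carrier) T →
                  upSum R w (inside ∷ T) ≈ upSum R (w ∘ (inside ∷_)) T
  upSum-inside∷ {n} w T = begin
    sumList R (map w (filter P? (map (outside ∷_) A ++ map (inside ∷_) A)))
      ≡⟨ ≡.cong (sumList R ∘ map w) (filter-++ P? (map (outside ∷_) A) _) ⟩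
    sumList R (map w (filter P? (map (outside ∷_) A) ++ filter P? (map (inside ∷_) A)))
      ≡⟨ ≡.cong₂ (λ xs ys → sumList R (map w (xs ++ ys)))
                 (filter-map-none P? (outside ∷_) (λ _ → ≡.refl) A)
                 (filter-map P? (T ⊆?_) (inside ∷_) (λ _ → ≡.refl) A) ⟩
    sumList R (map w (map (inside ∷_) (filter (T ⊆?_) A)))
      ≡⟨ ≡.cong (sumList R) (map-∘ (filter (T ⊆?_) A)) ⟨
    upSum R (w ∘ (inside ∷_)) T ∎
    where
    A = allSubsets n
    P? = (inside ∷ T) ⊆?_

  upSum-outside∷ : ∀ {n} (w : Subset (suc n) → Carrier) T →
                   upSum R w (outside ∷ T) ≈ upSum R (w ∘ (outside ∷_)) T + upSum R (w ∘ (inside ∷_)) T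
  upSum-outside∷ {n} w T = begin
    sumList R (map w (filter P? (map (outside ∷_) A ++ map (inside ∷_) A)))
      ≡⟨ ≡.cong (sumList R ∘ map w) (filter-++ P? (map (outside ∷_) A) _) ⟩
    sumList R (map w (filter P? (map (outside ∷_) A) ++ filter P? (map (inside ∷_) A)))
      ≡⟨ ≡.cong₂ (λ xs ys → sumList R (map w (xs ++ ys)))
                 (filter-map P? (T ⊆?_) (outside ∷_) (λ _ → ≡.refl) A)
                 (filter-map P? (T ⊆?_) (inside ∷_) (λ _ → ≡.refl) A) ⟩
    sumList R (map w (map (outside ∷_) A' ++ map (inside ∷_) A'))
      ≡⟨ ≡.cong (sumList R) (map-++ w (map (outside ∷_) A') _) ⟩
    sumList R (map w (map (outside ∷_) A') ++ map w (map (inside ∷_) A'))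
      ≈⟨ sumList-++ (map w (map (outside ∷_) A')) _ ⟩
    sumList R (map w (map (outside ∷_) A')) + sumList R (map w (map (inside ∷_) A'))
      ≡⟨ ≡.cong₂ (λ xs ys → sumList R xs + sumList R ys) (map-∘ A') (map-∘ A') ⟨
    upSum R (w ∘ (outside ∷_)) T + upSum R (w ∘ (inside ∷_)) T ∎
    where
    A = allSubsets n
    A' = filter (T ⊆?_) A
    P? = (outside ∷ T) ⊆?_

  totalMass≡upSum⊥ : ∀ {n} (w : Subset n → Carrier) → totalMass R w ≡ upSum R w ⊥
  totalMass≡upSum⊥ {n} w =
    ≡.cong (sumList R ∘ map w) (≡.sym (filter-all (⊥ ⊆?_) (universal (λ _ {_} → ⊥⊆) (allSubsets n))))

  productWeight : ∀ {n} → Carrier → Carrier → Subset n → Carrier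
  productWeight a b []            = 1#
  productWeight a b (inside ∷ T)  = a * productWeight a b T
  productWeight a b (outside ∷ T) = b * productWeight a b T

  upSum-productWeight : ∀ a b {n} (T : Subset n) → upSum R (productWeight a b) T ≈ productWeight a (a + b) T
  upSum-productWeight a b []            = +-identityʳ 1#
  upSum-productWeight a b (inside ∷ T)  = begin
    upSum R (productWeight a b) (inside ∷ T)   ≈⟨ upSum-inside∷ (productWeight a b) T ⟩
    upSum R (λ t → a * productWeight a b t) T  ≈⟨ upSum-*ˡ a (productWeight a b) T ⟩
    a * upSum R (productWeight a b) T          ≈⟨ *-congˡ (upSum-productWeight a b T) ⟩
    a * productWeight a (a + b) T              ∎
  upSum-productWeight a b (outside ∷ T) = begin
    upSum R (productWeight a b) (outside ∷ T)
      ≈⟨ upSum-outside∷ (productWeight a b) T ⟩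
    upSum R (λ t → b * productWeight a b t) T + upSum R (λ t → a * productWeight a b t) T
      ≈⟨ +-cong (upSum-*ˡ b (productWeight a b) T) (upSum-*ˡ a (productWeight a b) T) ⟩
    b * upSum R (productWeight a b) T + a * upSum R (productWeight a b) T
      ≈⟨ distribʳ _ b a ⟨
    (b + a) * upSum R (productWeight a b) T
      ≈⟨ *-cong (+-comm b a) (upSum-productWeight a b T) ⟩
    (a + b) * productWeight a (a + b) T ∎

  productWeight-⊤ : ∀ a b n → productWeight a b (⊤ {n}) ≡ a ^ n
  productWeight-⊤ a b zero    = ≡.refl
  productWeight-⊤ a b (suc n) = ≡.cong (a *_) (productWeight-⊤ a b n)

  productWeight-1 : ∀ {a b} → b ≈ 1# → ∀ {n} (T : Subset n) → productWeight a b T ≈ a ^ ∣ T ∣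
  productWeight-1 b≈1 []            = refl
  productWeight-1 b≈1 (inside ∷ T)  = *-congˡ (productWeight-1 b≈1 T)
  productWeight-1 b≈1 (outside ∷ T) = trans (*-cong b≈1 (productWeight-1 b≈1 T)) (*-identityˡ _)

  productWeight-0 : ∀ {a b} → b ≈ 0# → ∀ {n} (T : Subset n) → T ≢ ⊤ → productWeight a b T ≈ 0#
  productWeight-0 b≈0 []            []≢⊤ = ⊥-elim ([]≢⊤ ≡.refl)
  productWeight-0 b≈0 (inside ∷ T)  T≢⊤ =
    trans (*-congˡ (productWeight-0 b≈0 T (T≢⊤ ∘ ≡.cong (inside ∷_)))) (zeroʳ _)
  productWeight-0 b≈0 (outside ∷ T) _   = trans (*-congʳ b≈0) (zeroˡ _)

  productWeight-∣∣≤ : ∀ {a a′ b b′} → ∣ a′ ∣≤ a → ∣ b′ ∣≤ b →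
                      ∀ {n} (T : Subset n) → ∣ productWeight a′ b′ T ∣≤ productWeight a b T
  productWeight-∣∣≤ a′≤a b′≤b []            = x≤y⇒0≤y-x ≤-refl , +-nonneg 0≤1 0≤1
  productWeight-∣∣≤ a′≤a b′≤b (inside ∷ T)  = *-∣∣≤ a′≤a (productWeight-∣∣≤ a′≤a b′≤b T)
  productWeight-∣∣≤ a′≤a b′≤b (outside ∷ T) = *-∣∣≤ b′≤b (productWeight-∣∣≤ a′≤a b′≤b T)

  module Distribution (p : Carrier) (0≤p : 0# ≤ p) (p+p≤1 : p + p ≤ 1#) where

    q : Carrier
    q = 1# - p

    φ : ∀ {n} → Subset n → Carrier
    φ T = productWeight p q T - productWeight p (- p) T

    p+q≈1 : p + q ≈ 1#
    p+q≈1 = trans (sym (+-assoc p 1# (- p))) (xyx⁻¹≈y p 1#)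

    ∣p∣≤p : ∣ p ∣≤ p
    ∣p∣≤p = x≤y⇒0≤y-x ≤-refl , +-nonneg 0≤p 0≤p

    ∣-p∣≤q : ∣ - p ∣≤ q
    ∣-p∣≤q = ≤-respʳ-≈ 1≈q-[-p] 0≤1 , ≤-respʳ-≈ 1-[p+p]≈q-p (x≤y⇒0≤y-x p+p≤1)
      where
      1≈q-[-p] : 1# ≈ q - - p
      1≈q-[-p] = sym (trans (+-congˡ (-‿involutive p)) (trans (+-comm q p) p+q≈1))
      1-[p+p]≈q-p : 1# - (p + p) ≈ q - p
      1-[p+p]≈q-p = sym (trans (+-assoc 1# (- p) (- p)) (+-congˡ (-‿+-comm p p)))

    φ-nonneg : ∀ {n} (T : Subset n) → 0# ≤ φ T
    φ-nonneg T = proj₁ (productWeight-∣∣≤ ∣p∣≤p ∣-p∣≤q T)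

    φ-⊤ : ∀ n → φ (⊤ {n}) ≈ 0#
    φ-⊤ n = trans (reflexive (≡.cong₂ _-_ (productWeight-⊤ p q n) (productWeight-⊤ p (- p) n)))
                  (-‿inverseʳ (p ^ n))

    upSum-φ : ∀ {n} (T : Subset n) → T ≢ ⊤ → upSum R φ T ≈ p ^ ∣ T ∣
    upSum-φ T T≢⊤ = begin
      upSum R φ T
        ≈⟨ upSum-- (productWeight p q) (productWeight p (- p)) T ⟩
      upSum R (productWeight p q) T - upSum R (productWeight p (- p)) T
        ≈⟨ +-cong (upSum-productWeight p q T) (-‿cong (upSum-productWeight p (- p) T)) ⟩
      productWeight p (p + q) T - productWeight p (p - p) T
        ≈⟨ +-cong (productWeight-1 p+q≈1 T) (-‿cong (productWeight-0 (-‿inverseʳ p) T T≢⊤)) ⟩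
      p ^ ∣ T ∣ - 0#
        ≈⟨ x-0≈x (p ^ ∣ T ∣) ⟩
      p ^ ∣ T ∣ ∎

    totalMass-φ : ∀ n → totalMass R (φ {suc n}) ≈ 1#
    totalMass-φ n = begin
      totalMass R (φ {suc n})  ≡⟨ totalMass≡upSum⊥ (φ {suc n}) ⟩
      upSum R (φ {suc n}) ⊥    ≈⟨ upSum-φ {suc n} ⊥ (λ ()) ⟩
      p ^ ∣ ⊥ {suc n} ∣        ≡⟨ ≡.cong (p ^_) (∣⊥∣≡0 (suc n)) ⟩
      1#                       ∎

lemma3p1 : ∀ {c ℓ ℓ'} (R : OrderedCommutativeRing c ℓ ℓ') →
    let open OrderedCommutativeRing R in
    (r : ℕ) → 2 ≤ℕ r →
    (p : Carrier) → 0# < p → (p + p) ≤ 1# →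
    ∃ λ (φ : Subset r → Carrier) →
      IsProbDist R φ × (φ ⊤ ≈ 0#) ×
      (∀ (T : Subset r) → T ≢ ⊤ → upSum R φ T ≈ p ^ ∣ T ∣)
lemma3p1 R (suc r) _ p (0≤p , _) p+p≤1 = φ , (φ-nonneg , totalMass-φ r) , φ-⊤ (suc r) , upSum-φ
  where open Distribution R p 0≤p p+p≤1
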